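{- Let $p$ be a prime which is not a Fermat prime (i.e. $p$ is not of the form $2^{2^k}+1$ with $k\ge 0$). Then $L(p)=(p-3)/2$ if and only if $q=(p-1)/2$ is a prime and $2$ is a generator of the multiplicative group $(\mathbb{Z}/q\mathbb{Z})^{*}$.
   Context: For an integer $m\ge 2$, a cycle modulo $m$ of length $k\ge 1$ is a sequence $x_1,\dots,x_k$ of pairwise distinct residues modulo $m$ such that $x_i^2\equiv x_{i+1}\pmod m$ for $1\le i\le k-1$ and $x_k^2\equiv x_1\pmod m$. $L(m)$ denotes the maximum length of a cycle modulo $m$. -}

module Defs where

open import Data.Nat using (ℕ; zero; suc; _+_; _*_; _^_; _≤_; _<_)
open import Data.Nat.DivMod using (_%_)
open import Data.Nat.Coprimality using (Coprime)
open import Data.Fin using (Fin; inject₁; fromℕ) renaming (zero to fzero; suc to fsuc)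
open import Data.Product using (Σ; ∃; _×_)
open import Data.Empty using (⊥)
open import Function.Definitions using (Injective)
open import Relation.Binary.PropositionalEquality using (_≡_)

-- reduction of a natural number modulo m (for m = 0 we leave it unchanged;
-- this case never matters below since residues are required to be < m)
_mod_ : ℕ → ℕ → ℕ
x mod zero = x
x mod (suc m) = x % suc m

infix 4 _≡ₘ_[mod_]
_≡ₘ_[mod_] : ℕ → ℕ → ℕ → Set
a ≡ₘ b [mod m ] = a mod m ≡ b mod m

-- A cycle modulo m of length k = suc n: pairwise distinct residues
-- x₁ … x_k (natural numbers < m) with x_i² ≡ x_{i+1} and x_k² ≡ x₁ (mod m).
record IsCycle (m : ℕ) (n : ℕ) (x : Fin (suc n) → ℕ) : Set where
  field
    residue  : ∀ i → x i < m
    distinct : Injective _≡_ _≡_ x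
    step     : ∀ (i : Fin n) → x (inject₁ i) * x (inject₁ i) ≡ₘ x (fsuc i) [mod m ]
    close    : x (fromℕ n) * x (fromℕ n) ≡ₘ x fzero [mod m ]

HasCycleOfLength : ℕ → ℕ → Set
HasCycleOfLength m zero = ⊥
HasCycleOfLength m (suc n) = ∃ λ (x : Fin (suc n) → ℕ) → IsCycle m n x

MaxCycleLength : ℕ → ℕ → Set
MaxCycleLength m l = HasCycleOfLength m l × (∀ k → HasCycleOfLength m k → k ≤ l)

IsFermatNumber : ℕ → Set
IsFermatNumber p = ∃ λ k → p ≡ 2 ^ (2 ^ k) + 1

IsGeneratorModUnits : ℕ → ℕ → Set
IsGeneratorModUnits g q =
  Coprime g q × (∀ x → 1 ≤ x → x < q → Coprime x q → ∃ λ i → g ^ i ≡ₘ x [mod q ])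

module Submission where

-- Since r and p − r have congruent squares, every square of a unit modulo
-- p = 2q + 1 is z² for some 1 ≤ z ≤ q; the entries of a cycle of length ≥ 2,
-- together with 1, are distinct such squares, so every cycle has length at
-- most q − 1 (cycle-length-bound).  The entries of a cycle are the repeated
-- squares a ^ 2 ^ t of its first entry a, so they are distinct exactly when
-- the exponents 2 ^ t are distinct modulo the order of a.  A cycle of length
-- q − 1 therefore forces a to have order q and the powers of 2 to exhaust
-- (ℤ/qℤ)* (MaximalCycle); conversely, if q is prime and 2 generates, then 4
-- has order q modulo p and its repeated squares form a cycle of length q − 1
-- (GeneratorCycle).  The Fermat hypothesis only excludes p = 5, q = 2.
-- Before these we develop congruences and orders, arithmetic modulo a prime,
-- Fermat's little theorem, a pigeonhole principle and squares modulo 2q + 1.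

open import Defs
open import Data.Nat using (ℕ; _+_; _*_)
open import Data.Nat.Primality using (Prime)
open import Data.Product using (∃; _×_)
open import Function.Bundles using (_⇔_)
open import Relation.Nullary using (¬_)
open import Relation.Binary.PropositionalEquality using (_≡_)

open import Data.Nat
open import Data.Nat.Properties
open import Data.Nat.DivMod hiding (_mod_)
open import Data.Nat.Divisibility
open import Data.Nat.Primality
open import Data.Nat.Coprimality using (Coprime; prime⇒coprime; coprime-divisor) renaming (sym to coprime-sym)
open import Data.Nat.Combinatorics using (_C_; nCn≡1; nCk≡n!/k![n-k]!; k![n∸k]!∣n!)
open import Data.Nat.Tactic.RingSolver using (solve-∀)
open import Data.Fin using (Fin; toℕ; fromℕ; fromℕ<; inject₁; punchOut) renaming (zero to fzero; suc to fsuc)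
open import Data.Fin.Properties using (toℕ-fromℕ<; toℕ-inject₁; toℕ-fromℕ; toℕ<n; toℕ-injective; injective⇒≤; punchOut-injective; any?)
open import Data.Fin.Relation.Unary.Top using (view; ‵fromℕ; ‵inject₁)
open import Data.Product using (_,_; proj₁; proj₂)
open import Data.Sum using (_⊎_; inj₁; inj₂; [_,_]′; fromInj₁; fromInj₂)
open import Data.Empty using (⊥; ⊥-elim)
open import Function.Bundles using (mk⇔)
open import Function.Definitions using (Injective)
open import Relation.Nullary using (Dec; yes; no)
open import Relation.Nullary.Decidable using (map′; _×-dec_)
open import Relation.Binary.Bundles using (Setoid)
open import Algebra.Properties.Monoid.Sum +-0-monoid using (sum; sum-cong-≗; sum-init-last)
import Algebra.Properties.CommutativeSemiring.Binomial +-*-commutativeSemiring as Binomial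
import Algebra.Properties.Semiring.Exp +-*-semiring as SemiringExp
import Algebra.Definitions.RawMonoid +-0-rawMonoid as Multiples
import Relation.Binary.Reasoning.Setoid as SetoidReasoning
open import Relation.Binary.PropositionalEquality using (refl; sym; trans; cong; cong₂; subst; _≢_; module ≡-Reasoning)

Least : (ℕ → Set) → ℕ → Set
Least P e = P e × (∀ j → j < e → ¬ P j)

bounded-search : (P : ℕ → Set) → (∀ k → Dec (P k)) → ∀ n → (∀ j → j < n → ¬ P j) ⊎ ∃ (Least P)
bounded-search P P? zero    = inj₁ (λ j ())
bounded-search P P? (suc n) with bounded-search P P? n | P? n
... | inj₂ least | _      = inj₂ least
... | inj₁ none  | yes Pn = inj₂ (n , Pn , none)
... | inj₁ none  | no ¬Pn = inj₁ λ j j<1+n → [ none j , (λ { refl → ¬Pn }) ]′ (m<1+n⇒m<n∨m≡n j<1+n)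

least-witness : (P : ℕ → Set) → (∀ k → Dec (P k)) → ∀ {k} → P k → ∃ (Least P)
least-witness P P? {k} Pk = fromInj₂ (λ none → ⊥-elim (none k (n<1+n k) Pk)) (bounded-search P P? (suc k))

mod≡% : ∀ a m .{{_ : NonZero m}} → a mod m ≡ a % m
mod≡% a (suc m) = refl

-- Congruence modulo a fixed nonzero modulus m.  It is a record (rather than
-- an equation of remainders) so that both sides can be inferred from it.
module Congruence (m : ℕ) .{{_ : NonZero m}} where

  infix 4 _≈_
  record _≈_ (a b : ℕ) : Set where
    constructor mod-eq
    field same-remainder : a % m ≡ b % m
  open _≈_ public

  ≈-refl : ∀ {a} → a ≈ a
  ≈-refl = mod-eq refl

  ≈-sym : ∀ {a b} → a ≈ b → b ≈ a
  ≈-sym (mod-eq e) = mod-eq (sym e)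

  ≈-trans : ∀ {a b c} → a ≈ b → b ≈ c → a ≈ c
  ≈-trans (mod-eq e) (mod-eq f) = mod-eq (trans e f)

  ≡ₘ⇒≈ : ∀ {a b} → a ≡ₘ b [mod m ] → a ≈ b
  ≡ₘ⇒≈ {a} {b} e = mod-eq (trans (sym (mod≡% a m)) (trans e (mod≡% b m)))

  ≈⇒≡ₘ : ∀ {a b} → a ≈ b → a ≡ₘ b [mod m ]
  ≈⇒≡ₘ {a} {b} (mod-eq e) = trans (mod≡% a m) (trans e (sym (mod≡% b m)))

  ≡⇒≈ : ∀ {a b} → a ≡ b → a ≈ b
  ≡⇒≈ refl = ≈-refl

  ≈-setoid : Setoid _ _
  ≈-setoid = record
    { Carrier = ℕ ; _≈_ = _≈_
    ; isEquivalence = record { refl = ≈-refl ; sym = ≈-sym ; trans = ≈-trans } }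

  module ≈-Reasoning = SetoidReasoning ≈-setoid

  %-≈ : ∀ a → a % m ≈ a
  %-≈ a = mod-eq (m%n%n≡m%n a m)

  +-≈ : ∀ {a b c d} → a ≈ b → c ≈ d → a + c ≈ b + d
  +-≈ {a} {b} {c} {d} (mod-eq e) (mod-eq f) = mod-eq (begin
    (a + c) % m             ≡⟨ %-distribˡ-+ a c m ⟩
    (a % m + c % m) % m     ≡⟨ cong₂ (λ x y → (x + y) % m) e f ⟩
    (b % m + d % m) % m     ≡⟨ %-distribˡ-+ b d m ⟨
    (b + d) % m             ∎)
    where open ≡-Reasoning

  *-≈ : ∀ {a b c d} → a ≈ b → c ≈ d → a * c ≈ b * d
  *-≈ {a} {b} {c} {d} (mod-eq e) (mod-eq f) = mod-eq (begin
    (a * c) % m             ≡⟨ %-distribˡ-* a c m ⟩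
    (a % m * (c % m)) % m   ≡⟨ cong₂ (λ x y → (x * y) % m) e f ⟩
    (b % m * (d % m)) % m   ≡⟨ %-distribˡ-* b d m ⟨
    (b * d) % m             ∎)
    where open ≡-Reasoning

  ^-≈ : ∀ {a b} → a ≈ b → ∀ k → a ^ k ≈ b ^ k
  ^-≈ e zero    = ≈-refl
  ^-≈ e (suc k) = *-≈ e (^-≈ e k)

  +-multiple-≈ : ∀ a k → a + k * m ≈ a
  +-multiple-≈ a k = mod-eq ([m+kn]%n≡m%n a k m)

  ∸-square : ∀ {r} → r ≤ m → (m ∸ r) * (m ∸ r) ≈ r * r
  ∸-square {r} r≤m = begin
    s * s                          ≈⟨ +-multiple-≈ (s * s) (2 * r) ⟨
    s * s + 2 * r * m              ≡⟨ cong (λ t → s * s + 2 * r * t) s+r≡m ⟨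
    s * s + 2 * r * (s + r)        ≡⟨ square-identity s r ⟩
    r * r + (s + r) * (s + r)      ≡⟨ cong (λ t → r * r + t * t) s+r≡m ⟩
    r * r + m * m                  ≈⟨ +-multiple-≈ (r * r) m ⟩
    r * r                          ∎
    where
    open ≈-Reasoning
    s : ℕ
    s = m ∸ r
    s+r≡m : s + r ≡ m
    s+r≡m = m∸n+n≡m r≤m
    square-identity : ∀ s r → s * s + 2 * r * (s + r) ≡ r * r + (s + r) * (s + r)
    square-identity = solve-∀

  residue-≈⇒≡ : ∀ {a b} → a < m → b < m → a ≈ b → a ≡ b
  residue-≈⇒≡ a<m b<m (mod-eq e) = trans (sym (m<n⇒m%n≡m a<m)) (trans e (m<n⇒m%n≡m b<m))

  ∣∸⇒≈ : ∀ {a b} → b ≤ a → m ∣ a ∸ b → a ≈ b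
  ∣∸⇒≈ {a} {b} b≤a (divides k eq) = mod-eq (begin
    a % m              ≡⟨ cong (_% m) (m+[n∸m]≡n b≤a) ⟨
    (b + (a ∸ b)) % m  ≡⟨ cong (λ x → (b + x) % m) eq ⟩
    (b + k * m) % m    ≡⟨ [m+kn]%n≡m%n b k m ⟩
    b % m              ∎)
    where open ≡-Reasoning

  ≈⇒∣∸ : ∀ {a b} → b ≤ a → a ≈ b → m ∣ a ∸ b
  ≈⇒∣∸ {a} {b} b≤a (mod-eq e) = divides (a / m ∸ b / m) (begin
    a ∸ b                                     ≡⟨ cong₂ _∸_ (m≡m%n+[m/n]*n a m) (m≡m%n+[m/n]*n b m) ⟩
    (a % m + a / m * m) ∸ (b % m + b / m * m) ≡⟨ cong (λ x → (a % m + a / m * m) ∸ (x + b / m * m)) e ⟨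
    (a % m + a / m * m) ∸ (a % m + b / m * m) ≡⟨ [m+n]∸[m+o]≡n∸o (a % m) _ _ ⟩
    a / m * m ∸ b / m * m                     ≡⟨ *-distribʳ-∸ m (a / m) (b / m) ⟨
    (a / m ∸ b / m) * m                       ∎)
    where open ≡-Reasoning

  ∣⇒≈0 : ∀ {a} → m ∣ a → a ≈ 0
  ∣⇒≈0 {a} m∣a = ∣∸⇒≈ z≤n m∣a

  pow-≈-exponent-mod : ∀ a e .{{_ : NonZero e}} → a ^ e ≈ 1 → ∀ k → a ^ k ≈ a ^ (k % e)
  pow-≈-exponent-mod a e aᵉ≈1 k = begin
    a ^ k                             ≡⟨ cong (a ^_) (m≡m%n+[m/n]*n k e) ⟩
    a ^ (k % e + k / e * e)           ≡⟨ ^-distribˡ-+-* a (k % e) (k / e * e) ⟩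
    a ^ (k % e) * a ^ (k / e * e)     ≡⟨ cong (λ t → a ^ (k % e) * a ^ t) (*-comm (k / e) e) ⟩
    a ^ (k % e) * a ^ (e * (k / e))   ≡⟨ cong (a ^ (k % e) *_) (^-*-assoc a e (k / e)) ⟨
    a ^ (k % e) * (a ^ e) ^ (k / e)   ≈⟨ *-≈ (≈-refl {a ^ (k % e)}) (^-≈ aᵉ≈1 (k / e)) ⟩
    a ^ (k % e) * 1 ^ (k / e)         ≡⟨ cong (a ^ (k % e) *_) (^-zeroˡ (k / e)) ⟩
    a ^ (k % e) * 1                   ≡⟨ *-identityʳ _ ⟩
    a ^ (k % e)                       ∎
    where open ≈-Reasoning

  record Order (a : ℕ) : Set where
    field
      order     : ℕ
      order>0   : 0 < order
      pow-order : a ^ order ≈ 1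
      minimal   : ∀ j → 0 < j → j < order → ¬ a ^ j ≈ 1

  order-of : ∀ a k → 0 < k → a ^ k ≈ 1 → Order a
  order-of a k k>0 aᵏ≈1 = least-order (least-witness _ decide (k>0 , aᵏ≈1))
    where
    decide : ∀ j → Dec (0 < j × a ^ j ≈ 1)
    decide j = (0 <? j) ×-dec map′ mod-eq same-remainder (a ^ j % m ≟ 1 % m)
    least-order : ∃ (Least (λ j → 0 < j × a ^ j ≈ 1)) → Order a
    least-order (e , (e>0 , aᵉ≈1) , below) = record
      { order = e ; order>0 = e>0 ; pow-order = aᵉ≈1
      ; minimal = λ j j>0 j<e aʲ≈1 → below j j<e (j>0 , aʲ≈1) }

  module OrderFacts {a : ℕ} (o : Order a) where
    open Order o public
    instance
      order≢0 : NonZero order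
      order≢0 = >-nonZero order>0

    pow-≈-order : ∀ {i j} → i % order ≡ j % order → a ^ i ≈ a ^ j
    pow-≈-order {i} {j} i≡j = begin
      a ^ i             ≈⟨ pow-≈-exponent-mod a order pow-order i ⟩
      a ^ (i % order)   ≡⟨ cong (a ^_) i≡j ⟩
      a ^ (j % order)   ≈⟨ pow-≈-exponent-mod a order pow-order j ⟨
      a ^ j             ∎
      where open ≈-Reasoning

    order-∣ : ∀ {k} → a ^ k ≈ 1 → order ∣ k
    order-∣ {k} aᵏ≈1 with k % order in r≡
    ... | zero  = m%n≡0⇒n∣m k order r≡
    ... | suc r = ⊥-elim (minimal (suc r) z<s (subst (_< order) r≡ (m%n<n k order)) aʳ⁺¹≈1)
      where
      aʳ⁺¹≈1 : a ^ suc r ≈ 1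
      aʳ⁺¹≈1 = begin
        a ^ suc r         ≡⟨ cong (a ^_) r≡ ⟨
        a ^ (k % order)   ≈⟨ pow-≈-exponent-mod a order pow-order k ⟨
        a ^ k             ≈⟨ aᵏ≈1 ⟩
        1                 ∎
        where open ≈-Reasoning

residue∤ : ∀ {m a} → 0 < a → a < m → m ∤ a
residue∤ {a = suc _} _ a<m = >⇒∤ a<m

prime>1 : ∀ {p} → Prime p → 1 < p
prime>1 {p} p-prime = nonTrivial⇒n>1 p {{prime⇒nonTrivial p-prime}}

module PrimeModulus (p : ℕ) (p-prime : Prime p) where

  instance
    p≢0 : NonZero p
    p≢0 = prime⇒nonZero p-prime

  open Congruence p public

  1<p : 1 < p
  1<p = prime>1 p-prime

  ∤1 : p ∤ 1
  ∤1 = >⇒∤ 1<p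

  ∤-* : ∀ {a b} → p ∤ a → p ∤ b → p ∤ a * b
  ∤-* {a} {b} p∤a p∤b p∣ab = [ p∤a , p∤b ]′ (euclidsLemma a b p-prime p∣ab)

  ∤-^ : ∀ {a} → p ∤ a → ∀ k → p ∤ a ^ k
  ∤-^ p∤a zero    = ∤1
  ∤-^ p∤a (suc k) = ∤-* p∤a (∤-^ p∤a k)

  -- for c ≤ b, p divides a * (b ∸ c) but not a, hence it divides b ∸ c
  cancel-≥ : ∀ {a b c} → p ∤ a → c ≤ b → a * b ≈ a * c → b ≈ c
  cancel-≥ {a} {b} {c} p∤a c≤b ab≈ac =
    ∣∸⇒≈ c≤b (fromInj₂ (λ p∣a → ⊥-elim (p∤a p∣a)) (euclidsLemma a (b ∸ c) p-prime p∣a[b∸c]))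
    where
    p∣a[b∸c] : p ∣ a * (b ∸ c)
    p∣a[b∸c] = subst (p ∣_) (sym (*-distribˡ-∸ a b c)) (≈⇒∣∸ (*-monoʳ-≤ a c≤b) ab≈ac)

  cancel : ∀ {a b c} → p ∤ a → a * b ≈ a * c → b ≈ c
  cancel {b = b} {c} p∤a ab≈ac with ≤-total b c
  ... | inj₁ b≤c = ≈-sym (cancel-≥ p∤a b≤c (≈-sym ab≈ac))
  ... | inj₂ c≤b = cancel-≥ p∤a c≤b ab≈ac

  module UnitOrder {a : ℕ} (p∤a : p ∤ a) (o : Order a) where
    open OrderFacts o public
    private module ModOrder = Congruence order

    pow-≈⇒order-∣ : ∀ {i j} → i ≤ j → a ^ i ≈ a ^ j → order ∣ j ∸ i
    pow-≈⇒order-∣ {i} {j} i≤j aⁱ≈aʲ = order-∣ (cancel (∤-^ p∤a i) (begin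
      a ^ i * a ^ (j ∸ i)   ≡⟨ ^-distribˡ-+-* a i (j ∸ i) ⟨
      a ^ (i + (j ∸ i))     ≡⟨ cong (a ^_) (m+[n∸m]≡n i≤j) ⟩
      a ^ j                 ≈⟨ aⁱ≈aʲ ⟨
      a ^ i                 ≡⟨ *-identityʳ (a ^ i) ⟨
      a ^ i * 1             ∎))
      where open ≈-Reasoning

    pow-injective : ∀ {i j} → a ^ i ≈ a ^ j → i % order ≡ j % order
    pow-injective {i} {j} aⁱ≈aʲ with ≤-total i j
    ... | inj₁ i≤j = sym (ModOrder.same-remainder (ModOrder.∣∸⇒≈ i≤j (pow-≈⇒order-∣ i≤j aⁱ≈aʲ)))
    ... | inj₂ j≤i = ModOrder.same-remainder (ModOrder.∣∸⇒≈ j≤i (pow-≈⇒order-∣ j≤i (≈-sym aⁱ≈aʲ)))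

    pow-injective-below : ∀ {i j} → i < order → j < order → a ^ i ≈ a ^ j → i ≡ j
    pow-injective-below i<o j<o aⁱ≈aʲ =
      trans (sym (m<n⇒m%n≡m i<o)) (trans (pow-injective aⁱ≈aʲ) (m<n⇒m%n≡m j<o))

-- The binomial theorem over ℕ with y = 1, in terms of ℕ's own operations.
binomial-theorem : ∀ a n → (a + 1) ^ n ≡ sum (λ (k : Fin (suc n)) → (n C toℕ k) * a ^ toℕ k)
binomial-theorem a n = begin
  (a + 1) ^ n                 ≡⟨ semiring-^ (a + 1) n ⟨
  (a + 1) SemiringExp.^ n     ≡⟨ Binomial.theorem n a 1 ⟩
  Binomial.binomialExpansion a 1 n ≡⟨ sum-cong-≗ {suc n} term ⟩
  sum (λ (k : Fin (suc n)) → (n C toℕ k) * a ^ toℕ k) ∎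
  where
  open ≡-Reasoning
  semiring-^ : ∀ x k → x SemiringExp.^ k ≡ x ^ k
  semiring-^ x zero    = refl
  semiring-^ x (suc k) = cong (x *_) (semiring-^ x k)
  multiple : ∀ k x → k Multiples.× x ≡ k * x
  multiple zero    x = refl
  multiple (suc k) x = cong (x +_) (multiple k x)
  term : ∀ (k : Fin (suc n)) → Binomial.binomialTerm a 1 n k ≡ (n C toℕ k) * a ^ toℕ k
  term k = begin
    (n C toℕ k) Multiples.× (a SemiringExp.^ toℕ k * 1 SemiringExp.^ (n ∸ toℕ k))
      ≡⟨ multiple (n C toℕ k) _ ⟩
    (n C toℕ k) * (a SemiringExp.^ toℕ k * 1 SemiringExp.^ (n ∸ toℕ k))
      ≡⟨ cong₂ (λ u v → (n C toℕ k) * (u * v)) (semiring-^ a (toℕ k)) (trans (semiring-^ 1 (n ∸ toℕ k)) (^-zeroˡ (n ∸ toℕ k))) ⟩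
    (n C toℕ k) * (a ^ toℕ k * 1)
      ≡⟨ cong (λ t → (n C toℕ k) * t) (*-identityʳ (a ^ toℕ k)) ⟩
    (n C toℕ k) * a ^ toℕ k ∎

inner-terms : ℕ → (n : ℕ) → Fin n → ℕ
inner-terms a n i = (suc n C suc (toℕ i)) * a ^ suc (toℕ i)

binomial-ends : ∀ a n → (a + 1) ^ suc n ≡ 1 + (sum (inner-terms a n) + a ^ suc n)
binomial-ends a n = begin
  (a + 1) ^ suc n                              ≡⟨ binomial-theorem a (suc n) ⟩
  term fzero + sum (λ i → term (fsuc i))       ≡⟨ cong₂ _+_ first (sum-init-last (λ i → term (fsuc i))) ⟩
  1 + (sum (λ i → term (fsuc (inject₁ i))) + term (fsuc (fromℕ n)))
      ≡⟨ cong (λ t → 1 + (t + term (fsuc (fromℕ n)))) (sum-cong-≗ {n} inner) ⟩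
  1 + (sum (inner-terms a n) + term (fsuc (fromℕ n)))
      ≡⟨ cong (λ t → 1 + (sum (inner-terms a n) + t)) last ⟩
  1 + (sum (inner-terms a n) + a ^ suc n)      ∎
  where
  open ≡-Reasoning
  term : Fin (suc (suc n)) → ℕ
  term k = (suc n C toℕ k) * a ^ toℕ k
  first : term fzero ≡ 1
  first = refl
  inner : ∀ i → term (fsuc (inject₁ i)) ≡ inner-terms a n i
  inner i = cong (λ t → (suc n C suc t) * a ^ suc t) (toℕ-inject₁ i)
  last : term (fsuc (fromℕ n)) ≡ a ^ suc n
  last = begin
    (suc n C suc (toℕ (fromℕ n))) * a ^ suc (toℕ (fromℕ n)) ≡⟨ cong (λ t → (suc n C suc t) * a ^ suc t) (toℕ-fromℕ n) ⟩
    (suc n C suc n) * a ^ suc n                             ≡⟨ cong (_* a ^ suc n) (nCn≡1 (suc n)) ⟩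
    1 * a ^ suc n                                         ≡⟨ *-identityˡ (a ^ suc n) ⟩
    a ^ suc n                                             ∎

∣-sum : ∀ {d n} (f : Fin n → ℕ) → (∀ i → d ∣ f i) → d ∣ sum f
∣-sum {d} {zero} f _ = d ∣0
∣-sum {d} {suc n} f d∣f = ∣m∣n⇒∣m+n (d∣f fzero) (∣-sum (λ i → f (fsuc i)) (λ i → d∣f (fsuc i)))

prime∤! : ∀ {p} → Prime p → ∀ k → k < p → p ∤ k !
prime∤! p-prime zero    _   = >⇒∤ (prime>1 p-prime)
prime∤! p-prime (suc k) k<p p∣k! =
  [ >⇒∤ k<p , prime∤! p-prime k (<-trans (n<1+n k) k<p) ]′ (euclidsLemma (suc k) (k !) p-prime p∣k!)

-- A prime p divides the binomial coefficients p C k with 0 < k < p, since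
-- p C k * (k ! * (p ∸ k) !) = p ! and p divides neither factorial.
prime∣C : ∀ {p k} → Prime p → 0 < k → k < p → p ∣ p C k
prime∣C {p@(suc p′)} {k} p-prime k>0 k<p =
  fromInj₁ (λ p∣!*! → ⊥-elim (p∤!*! (euclidsLemma (k !) ((p ∸ k) !) p-prime p∣!*!)))
           (euclidsLemma (p C k) (k ! * (p ∸ k) !) p-prime (subst (p ∣_) (sym C*!*!≡!) p∣p!))
  where
  C*!*!≡! : (p C k) * (k ! * (p ∸ k) !) ≡ p !
  C*!*!≡! = trans (cong (_* (k ! * (p ∸ k) !)) (nCk≡n!/k![n-k]! (<⇒≤ k<p)))
                  (m/n*n≡m {{k !* (p ∸ k) !≢0}} (k![n∸k]!∣n! (<⇒≤ k<p)))
  p∣p! : p ∣ p !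
  p∣p! = ∣m⇒∣m*n (p′ !) ∣-refl
  p∤!*! : ¬ (p ∣ k ! ⊎ p ∣ (p ∸ k) !)
  p∤!*! = [ prime∤! p-prime k k<p , prime∤! p-prime (p ∸ k) (∸-monoʳ-< k>0 (<⇒≤ k<p)) ]′

-- Fermat's little theorem, via the "freshman's dream" (a + 1) ^ p ≈ a ^ p + 1.
module Fermat (p : ℕ) (p-prime : Prime p) where
  open PrimeModulus p p-prime

  p-1+1≡p : suc (p ∸ 1) ≡ p
  p-1+1≡p = m+[n∸m]≡n (<⇒≤ 1<p)

  freshman's-dream : ∀ a → (a + 1) ^ p ≈ a ^ p + 1
  freshman's-dream a = subst (λ e → (a + 1) ^ e ≈ a ^ e + 1) p-1+1≡p (begin
    (a + 1) ^ suc n                           ≡⟨ binomial-ends a n ⟩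
    1 + (sum (inner-terms a n) + a ^ suc n)   ≈⟨ +-≈ (≈-refl {1}) (+-≈ (∣⇒≈0 (∣-sum _ p∣inner)) (≈-refl {a ^ suc n})) ⟩
    1 + (0 + a ^ suc n)                       ≡⟨ +-comm 1 (a ^ suc n) ⟩
    a ^ suc n + 1                             ∎)
    where
    open ≈-Reasoning
    n : ℕ
    n = p ∸ 1
    p∣inner : ∀ i → p ∣ inner-terms a n i
    p∣inner i = ∣m⇒∣m*n _ (subst (λ e → p ∣ e C suc (toℕ i)) (sym p-1+1≡p)
                   (prime∣C p-prime z<s (subst (suc (toℕ i) <_) p-1+1≡p (s≤s (toℕ<n i)))))

  fermat : ∀ a → a ^ p ≈ a
  fermat zero    = subst (λ e → 0 ^ e ≈ 0) p-1+1≡p ≈-refl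
  fermat (suc a) = begin
    suc a ^ p     ≡⟨ cong (_^ p) (+-comm 1 a) ⟩
    (a + 1) ^ p   ≈⟨ freshman's-dream a ⟩
    a ^ p + 1     ≈⟨ +-≈ (fermat a) (≈-refl {1}) ⟩
    a + 1         ≡⟨ +-comm a 1 ⟩
    suc a         ∎
    where open ≈-Reasoning

  fermat-unit : ∀ {a} → p ∤ a → a ^ (p ∸ 1) ≈ 1
  fermat-unit {a} p∤a = cancel p∤a (begin
    a * a ^ (p ∸ 1)   ≡⟨ cong (a ^_) p-1+1≡p ⟩
    a ^ p             ≈⟨ fermat a ⟩
    a                 ≡⟨ *-identityʳ a ⟨
    a * 1             ∎)
    where open ≈-Reasoning

  -- for p = 2q + 1: 4 ^ q = 2 ^ (p − 1) ≈ 1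
  4^q≈1 : ∀ {q} → 2 * q + 1 ≡ p → p ∤ 2 → 4 ^ q ≈ 1
  4^q≈1 {q} 2q+1≡p p∤2 = begin
    4 ^ q                 ≡⟨ ^-*-assoc 2 2 q ⟩
    2 ^ (2 * q)           ≡⟨ cong (λ e → 2 ^ (e ∸ 1)) (trans (+-comm 1 (2 * q)) 2q+1≡p) ⟩
    2 ^ (p ∸ 1)           ≈⟨ fermat-unit p∤2 ⟩
    1                     ∎
    where open ≈-Reasoning

interval-index : ∀ lo c x → lo ≤ x → x < lo + c → Fin c
interval-index lo c x lo≤x x<lo+c = fromℕ< (subst (x ∸ lo <_) (m+n∸m≡n lo c) (∸-monoˡ-< x<lo+c lo≤x))

interval-index-injective : ∀ {lo c x y} (lo≤x : lo ≤ x) (x< : x < lo + c) (lo≤y : lo ≤ y) (y< : y < lo + c) →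
                           interval-index lo c x lo≤x x< ≡ interval-index lo c y lo≤y y< → x ≡ y
interval-index-injective {lo} {c} {x} {y} lo≤x x< lo≤y y< i≡j = begin
  x             ≡⟨ m∸n+n≡m lo≤x ⟨
  x ∸ lo + lo   ≡⟨ cong (_+ lo) (trans (sym (toℕ-fromℕ< _)) (trans (cong toℕ i≡j) (toℕ-fromℕ< _))) ⟩
  y ∸ lo + lo   ≡⟨ m∸n+n≡m lo≤y ⟩
  y             ∎
  where open ≡-Reasoning

injective-in-interval⇒≤ : ∀ {k} lo c (f : Fin k → ℕ) → (∀ i → lo ≤ f i) → (∀ i → f i < lo + c) →
                          Injective _≡_ _≡_ f → k ≤ c
injective-in-interval⇒≤ lo c f lo≤f f< f-inj =
  injective⇒≤ {f = λ i → interval-index lo c (f i) (lo≤f i) (f< i)}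
              (λ {i} {j} e → f-inj (interval-index-injective (lo≤f i) (f< i) (lo≤f j) (f< j) e))

injective-in-interval⇒onto : ∀ {k} lo (f : Fin k → ℕ) → (∀ i → lo ≤ f i) → (∀ i → f i < lo + k) →
                             Injective _≡_ _≡_ f → ∀ y → lo ≤ y → y < lo + k → ∃ λ i → f i ≡ y
injective-in-interval⇒onto {zero} lo f lo≤f f< f-inj y lo≤y y< =
  ⊥-elim (<⇒≱ y< (subst (_≤ y) (sym (+-identityʳ lo)) lo≤y))
injective-in-interval⇒onto {suc k} lo f lo≤f f< f-inj y lo≤y y< with any? (λ i → f i ≟ y)
... | yes hit = hit
... | no miss = ⊥-elim (<⇒≱ (n<1+n k) (injective⇒≤ {f = avoid} avoid-injective))
  where
  index : ∀ {x} → lo ≤ x → x < lo + suc k → Fin (suc k)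
  index {x} = interval-index lo (suc k) x
  y≢f : ∀ i → index lo≤y y< ≢ index (lo≤f i) (f< i)
  y≢f i e = miss (i , sym (interval-index-injective lo≤y y< (lo≤f i) (f< i) e))
  -- the indices of f avoid the index of y, so f squeezes into k places
  avoid : Fin (suc k) → Fin k
  avoid i = punchOut (y≢f i)
  avoid-injective : Injective _≡_ _≡_ avoid
  avoid-injective {i} {j} e =
    f-inj (interval-index-injective (lo≤f i) (f< i) (lo≤f j) (f< j) (punchOut-injective (y≢f i) (y≢f j) e))

-- Squares modulo an odd modulus m = 2q + 1.  Since r and m ∸ r have the same
-- square, every square of a unit is the square of some z with 1 ≤ z ≤ q; so at
-- most q pairwise incongruent residues are squares of units.
module OddModulus (m : ℕ) .{{_ : NonZero m}} (q : ℕ) (2q+1≡m : 2 * q + 1 ≡ m) where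
  open Congruence m

  1≤remainder : ∀ {y} → m ∤ y → 1 ≤ y % m
  1≤remainder {y} m∤y = n≢0⇒n>0 (λ r≡0 → m∤y (m%n≡0⇒n∣m y m r≡0))

  square≈square-remainder : ∀ y → y * y ≈ y % m * (y % m)
  square≈square-remainder y = *-≈ (≈-sym (%-≈ y)) (≈-sym (%-≈ y))

  reflected-≤ : ∀ {r} → q < r → m ∸ r ≤ q
  reflected-≤ {r} q<r = m≤n+o⇒m∸n≤o m r (subst (_≤ r + q) (trans (odd q) 2q+1≡m) (+-monoˡ-≤ q q<r))
    where
    odd : ∀ q → suc q + q ≡ 2 * q + 1
    odd = solve-∀

  -- every square of a unit is the square of some z with 1 ≤ z ≤ q: the
  -- remainder r = y % m itself if r ≤ q, and m ∸ r otherwise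
  unit-square-root : ∀ {y} → m ∤ y → ∃ λ z → 1 ≤ z × z ≤ q × y * y ≈ z * z
  unit-square-root {y} m∤y with y % m ≤? q
  ... | yes r≤q = y % m , 1≤remainder m∤y , r≤q , square≈square-remainder y
  ... | no  r≰q = m ∸ y % m , m<n⇒0<n∸m (m%n<n y m) , reflected-≤ (≰⇒> r≰q) ,
                  ≈-trans (square≈square-remainder y) (≈-sym (∸-square (<⇒≤ (m%n<n y m))))

  distinct-unit-squares-bound : ∀ {k} (f y : Fin k → ℕ) → (∀ i → m ∤ y i) → (∀ i → f i ≈ y i * y i) →
                                (∀ {i j} → f i ≈ f j → i ≡ j) → k ≤ q
  distinct-unit-squares-bound f y m∤y f≈y² f-inj =
    injective-in-interval⇒≤ 1 q z (λ i → proj₁ (proj₂ (root i))) (λ i → s≤s (proj₁ (proj₂ (proj₂ (root i))))) z-inj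
    where
    root : ∀ i → ∃ λ z → 1 ≤ z × z ≤ q × y i * y i ≈ z * z
    root i = unit-square-root (m∤y i)
    z : Fin _ → ℕ
    z i = proj₁ (root i)
    f≈z² : ∀ i → f i ≈ z i * z i
    f≈z² i = ≈-trans (f≈y² i) (proj₂ (proj₂ (proj₂ (root i))))
    z-inj : Injective _≡_ _≡_ z
    z-inj {i} {j} zᵢ≡zⱼ = f-inj (≈-trans (f≈z² i) (≈-trans (≡⇒≈ (cong (λ t → t * t) zᵢ≡zⱼ)) (≈-sym (f≈z² j))))

square-of-power : ∀ a k → a ^ (2 ^ k) * a ^ (2 ^ k) ≡ a ^ (2 ^ suc k)
square-of-power a k = begin
  a ^ (2 ^ k) * a ^ (2 ^ k)   ≡⟨ ^-distribˡ-+-* a (2 ^ k) (2 ^ k) ⟨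
  a ^ (2 ^ k + 2 ^ k)         ≡⟨ cong (λ t → a ^ (2 ^ k + t)) (+-identityʳ (2 ^ k)) ⟨
  a ^ (2 ^ suc k)             ∎
  where open ≡-Reasoning

module CycleStructure {m : ℕ} .{{_ : NonZero m}} {n : ℕ} {x : Fin (suc n) → ℕ} (c : IsCycle m n x) where
  open Congruence m
  open IsCycle c

  entries-distinct : ∀ {i j} → x i ≈ x j → i ≡ j
  entries-distinct {i} {j} xᵢ≈xⱼ = distinct (residue-≈⇒≡ (residue i) (residue j) xᵢ≈xⱼ)

  next : ∀ i → ∃ λ j → x i * x i ≈ x j × (0 < n → j ≢ i)
  next i with view i
  ... | ‵fromℕ     = fzero , ≡ₘ⇒≈ close , λ n>0 0≡n → <⇒≢ n>0 (trans (cong toℕ 0≡n) (toℕ-fromℕ n))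
  ... | ‵inject₁ j = fsuc j , ≡ₘ⇒≈ (step j) ,
                     λ _ j+1≡j → <⇒≢ (n<1+n (toℕ j)) (trans (sym (toℕ-inject₁ j)) (cong toℕ (sym j+1≡j)))

  prev : ∀ i → ∃ λ j → x j * x j ≈ x i
  prev fzero    = fromℕ n , ≡ₘ⇒≈ close
  prev (fsuc j) = inject₁ j , ≡ₘ⇒≈ (step j)

  not-fixed : 0 < n → ∀ i → ¬ x i * x i ≈ x i
  not-fixed n>0 i xᵢ²≈xᵢ with next i
  ... | j , xᵢ²≈xⱼ , j≢i = j≢i n>0 (entries-distinct (≈-trans (≈-sym xᵢ²≈xⱼ) xᵢ²≈xᵢ))

  entry-unit : 0 < n → ∀ i → m ∤ x i
  entry-unit n>0 i m∣xᵢ = not-fixed n>0 i (≈-trans (*-≈ xᵢ≈0 xᵢ≈0) (≈-sym xᵢ≈0))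
    where
    xᵢ≈0 : x i ≈ 0
    xᵢ≈0 = ∣⇒≈0 m∣xᵢ

  entry≉1 : 0 < n → ∀ i → ¬ x i ≈ 1
  entry≉1 n>0 i xᵢ≈1 = not-fixed n>0 i (≈-trans (*-≈ xᵢ≈1 xᵢ≈1) (≈-sym xᵢ≈1))

  entry-power : ∀ t i → toℕ i ≡ t → x i ≈ x fzero ^ (2 ^ t)
  entry-power zero    fzero    _     = ≡⇒≈ (sym (*-identityʳ (x fzero)))
  entry-power (suc t) (fsuc j) j+1≡t = begin
    x (fsuc j)                                     ≈⟨ ≡ₘ⇒≈ (step j) ⟨
    x (inject₁ j) * x (inject₁ j)                  ≈⟨ *-≈ previous previous ⟩
    x fzero ^ (2 ^ t) * x fzero ^ (2 ^ t)          ≡⟨ square-of-power (x fzero) t ⟩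
    x fzero ^ (2 ^ suc t)                          ∎
    where
    open ≈-Reasoning
    previous : x (inject₁ j) ≈ x fzero ^ (2 ^ t)
    previous = entry-power t (inject₁ j) (trans (toℕ-inject₁ j) (suc-injective j+1≡t))

  first-returns : x fzero ^ (2 ^ suc n) ≈ x fzero
  first-returns = begin
    x fzero ^ (2 ^ suc n)                          ≡⟨ square-of-power (x fzero) n ⟨
    x fzero ^ (2 ^ n) * x fzero ^ (2 ^ n)          ≈⟨ *-≈ last last ⟨
    x (fromℕ n) * x (fromℕ n)                      ≈⟨ ≡ₘ⇒≈ close ⟩
    x fzero                                        ∎
    where
    open ≈-Reasoning
    last : x (fromℕ n) ≈ x fzero ^ (2 ^ n)
    last = entry-power n (fromℕ n) (toℕ-fromℕ n)

-- A cycle of length n + 1 ≥ 2 modulo 2q + 1 has length at most q − 1: its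
-- entries together with 1 are q + 2 pairwise incongruent squares of units.
cycle-length-bound : ∀ {m} .{{_ : NonZero m}} q → 2 * q + 1 ≡ m →
                     ∀ {n x} → IsCycle m n x → 0 < n → suc (suc n) ≤ q
cycle-length-bound {m} q 2q+1≡m {n} {x} c n>0 =
  OddModulus.distinct-unit-squares-bound m q 2q+1≡m f y m∤y f≈y² f-inj
  where
  open Congruence m
  open CycleStructure c
  f y : Fin (suc (suc n)) → ℕ
  f fzero    = 1
  f (fsuc i) = x i
  y fzero    = 1
  y (fsuc i) = x (proj₁ (prev i))
  m∤y : ∀ i → m ∤ y i
  m∤y fzero m∣1 = entry-unit n>0 fzero (∣-trans m∣1 (1∣ x fzero))
  m∤y (fsuc i)  = entry-unit n>0 (proj₁ (prev i))
  f≈y² : ∀ i → f i ≈ y i * y i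
  f≈y² fzero    = ≈-refl
  f≈y² (fsuc i) = ≈-sym (proj₂ (prev i))
  f-inj : ∀ {i j} → f i ≈ f j → i ≡ j
  f-inj {fzero}  {fzero}  _ = refl
  f-inj {fzero}  {fsuc j} 1≈xⱼ = ⊥-elim (entry≉1 n>0 j (≈-sym 1≈xⱼ))
  f-inj {fsuc i} {fzero}  xᵢ≈1 = ⊥-elim (entry≉1 n>0 i xᵢ≈1)
  f-inj {fsuc i} {fsuc j} xᵢ≈xⱼ = cong fsuc (entries-distinct xᵢ≈xⱼ)

-- Every cycle modulo 2q + 1, q = n + 2, thus has length at most n + 1 = q − 1.
cycle-length≤ : ∀ {m} .{{_ : NonZero m}} n → 2 * suc (suc n) + 1 ≡ m → ∀ k → HasCycleOfLength m k → k ≤ suc n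
cycle-length≤ n 2q+1≡m (suc zero)    _       = s≤s z≤n
cycle-length≤ n 2q+1≡m (suc (suc k)) (_ , c) = s≤s⁻¹ (cycle-length-bound (suc (suc n)) 2q+1≡m c z<s)

module _ {m : ℕ} .{{_ : NonZero m}} where
  open Congruence m

  squaring-cycle : ∀ a n → a ^ (2 ^ suc n) ≈ a →
                   (∀ {i j : Fin (suc n)} → a ^ (2 ^ toℕ i) ≈ a ^ (2 ^ toℕ j) → i ≡ j) →
                   IsCycle m n (λ i → a ^ (2 ^ toℕ i) % m)
  squaring-cycle a n returns powers-distinct = record
    { residue  = λ i → m%n<n (a ^ (2 ^ toℕ i)) m
    ; distinct = λ {i} {j} Xᵢ≡Xⱼ →
        powers-distinct (≈-trans (≈-sym (%-≈ _)) (≈-trans (≡⇒≈ Xᵢ≡Xⱼ) (%-≈ _)))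
    ; step     = λ i → ≈⇒≡ₘ (begin
        X (toℕ (inject₁ i)) * X (toℕ (inject₁ i))   ≡⟨ cong (λ t → X t * X t) (toℕ-inject₁ i) ⟩
        X (toℕ i) * X (toℕ i)                       ≈⟨ squared (toℕ i) ⟩
        a ^ (2 ^ suc (toℕ i))                       ≈⟨ %-≈ _ ⟨
        X (suc (toℕ i))                             ∎)
    ; close    = ≈⇒≡ₘ (begin
        X (toℕ (fromℕ n)) * X (toℕ (fromℕ n))       ≡⟨ cong (λ t → X t * X t) (toℕ-fromℕ n) ⟩
        X n * X n                                   ≈⟨ squared n ⟩
        a ^ (2 ^ suc n)                             ≈⟨ returns ⟩
        a                                           ≡⟨ *-identityʳ a ⟨
        a ^ (2 ^ 0)                                 ≈⟨ %-≈ _ ⟨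
        X 0                                         ∎)
    }
    where
    open ≈-Reasoning
    X : ℕ → ℕ
    X t = a ^ (2 ^ t) % m
    squared : ∀ t → X t * X t ≈ a ^ (2 ^ suc t)
    squared t = ≈-trans (*-≈ (%-≈ _) (%-≈ _)) (≡⇒≈ (square-of-power a t))

*-^ : ∀ a b k → (a * b) ^ k ≡ a ^ k * b ^ k
*-^ a b zero    = refl
*-^ a b (suc k) = trans (cong (a * b *_) (*-^ a b k)) (interchange a b (a ^ k) (b ^ k))
  where
  interchange : ∀ a b c d → a * b * (c * d) ≡ a * c * (b * d)
  interchange = solve-∀

%-modulus-≡ : ∀ k {d e} .{{_ : NonZero d}} .{{_ : NonZero e}} → d ≡ e → k % d ≡ k % e
%-modulus-≡ k refl = refl

odd∣2^⇒≡1 : ∀ {c} → ¬ 2 ∣ c → ∀ t → c ∣ 2 ^ t → c ≡ 1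
odd∣2^⇒≡1 2∤c zero    c∣1    = ∣1⇒≡1 c∣1
odd∣2^⇒≡1 2∤c (suc t) c∣2^t+1 = odd∣2^⇒≡1 2∤c t (coprime-divisor coprime-2 c∣2^t+1)
  where
  coprime-2 : Coprime _ 2
  coprime-2 (i∣c , i∣2) with prime⇒irreducible prime[2] i∣2
  ... | inj₁ i≡1  = i≡1
  ... | inj₂ refl = ⊥-elim (2∤c i∣c)

-- Let p = 2q + 1 be prime, q = n + 2, and let x₀, …, xₙ
-- be a cycle modulo p of length q − 1, the bound of cycle-length-bound.  Put
-- a = x₀, N = 2 ^ (n + 1) − 1 and d = the order of a, so a ^ N ≈ 1.
-- * d ≤ q: the powers a ^ j (j < d) are distinct squares of units, a being a square;
-- * q ≤ d: the exponents 2 ^ t mod d (t ≤ n) are distinct and nonzero, because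
--   xₜ ≈ a ^ (2 ^ t) and the xₜ are distinct and ≉ 1.
-- So d = q and the powers of 2 take all values 1, …, q − 1 modulo q: 2 is a
-- generator, and q is prime, since a proper divisor of q would divide a
-- power of 2 and also the odd number N (as q = d divides N).
module MaximalCycle (p : ℕ) (p-prime : Prime p) (n : ℕ) (2q+1≡p : 2 * suc (suc n) + 1 ≡ p)
                    (n>0 : 0 < n) {x : Fin (suc n) → ℕ} (c : IsCycle p n x) where
  open PrimeModulus p p-prime
  open CycleStructure c

  q : ℕ
  q = suc (suc n)

  a : ℕ
  a = x fzero

  -- a returns to itself after n + 1 squarings, so a ^ N ≈ 1 for N = 2 ^ (n + 1) − 1,
  -- an odd number
  N : ℕ
  N = 2 ^ suc n ∸ 1

  N+1≡2^[n+1] : suc N ≡ 2 ^ suc n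
  N+1≡2^[n+1] = m+[n∸m]≡n (m^n>0 2 (suc n))

  N>0 : 0 < N
  N>0 = m<n⇒0<n∸m (*-monoʳ-≤ 2 (m^n>0 2 n))

  N-odd : ¬ 2 ∣ N
  N-odd 2∣N = >⇒∤ (s≤s (s≤s z≤n)) (∣m+n∣m⇒∣n 2∣N+1 2∣N)
    where
    2∣N+1 : 2 ∣ N + 1
    2∣N+1 = subst (2 ∣_) (trans (sym N+1≡2^[n+1]) (+-comm 1 N)) (m∣m*n (2 ^ n))

  p∤a : p ∤ a
  p∤a = entry-unit n>0 fzero

  a^N≈1 : a ^ N ≈ 1
  a^N≈1 = cancel p∤a (begin
    a * a ^ N        ≡⟨ cong (a ^_) N+1≡2^[n+1] ⟩
    a ^ (2 ^ suc n)  ≈⟨ first-returns ⟩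
    a                ≡⟨ *-identityʳ a ⟨
    a * 1            ∎)
    where open ≈-Reasoning

  open UnitOrder p∤a (order-of a N N>0 a^N≈1)

  -- a = b * b with b the entry before x₀, so a ^ j = (b ^ j) * (b ^ j)
  order≤q : order ≤ q
  order≤q = OddModulus.distinct-unit-squares-bound p q 2q+1≡p (λ j → a ^ toℕ j) (λ j → b ^ toℕ j)
              (λ j → ∤-^ p∤b (toℕ j)) a^j≈[b^j]² powers-distinct
    where
    b : ℕ
    b = x (proj₁ (prev fzero))
    p∤b : p ∤ b
    p∤b = entry-unit n>0 (proj₁ (prev fzero))
    a^j≈[b^j]² : ∀ (j : Fin order) → a ^ toℕ j ≈ b ^ toℕ j * b ^ toℕ j
    a^j≈[b^j]² j = ≈-trans (^-≈ (≈-sym (proj₂ (prev fzero))) (toℕ j)) (≡⇒≈ (*-^ b b (toℕ j)))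
    powers-distinct : ∀ {i j : Fin order} → a ^ toℕ i ≈ a ^ toℕ j → i ≡ j
    powers-distinct aⁱ≈aʲ = toℕ-injective (pow-injective-below (toℕ<n _) (toℕ<n _) aⁱ≈aʲ)

  exponent : Fin (suc n) → ℕ
  exponent t = 2 ^ toℕ t % order

  entry≈a^exponent : ∀ t → x t ≈ a ^ exponent t
  entry≈a^exponent t = ≈-trans (entry-power (toℕ t) t refl) (pow-≈-exponent-mod a order pow-order (2 ^ toℕ t))

  exponent-positive : ∀ t → 1 ≤ exponent t
  exponent-positive t = n≢0⇒n>0 λ eₜ≡0 → entry≉1 n>0 t (≈-trans (entry≈a^exponent t) (≡⇒≈ (cong (a ^_) eₜ≡0)))

  exponent-injective : Injective _≡_ _≡_ exponent
  exponent-injective {s} {t} eₛ≡eₜ = entries-distinct (begin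
    x s              ≈⟨ entry≈a^exponent s ⟩
    a ^ exponent s   ≡⟨ cong (a ^_) eₛ≡eₜ ⟩
    a ^ exponent t   ≈⟨ entry≈a^exponent t ⟨
    x t              ∎)
    where open ≈-Reasoning

  exponent<1+[order-1] : ∀ t → exponent t < 1 + (order ∸ 1)
  exponent<1+[order-1] t = subst (exponent t <_) (sym (m+[n∸m]≡n order>0)) (m%n<n (2 ^ toℕ t) order)

  -- the n + 1 exponents lie in [1, order), so q ≤ order
  order≡q : order ≡ q
  order≡q = ≤-antisym order≤q (subst (q ≤_) (m+[n∸m]≡n order>0)
    (s≤s (injective-in-interval⇒≤ 1 (order ∸ 1) exponent exponent-positive exponent<1+[order-1] exponent-injective)))

  powers-of-2-onto : ∀ y → 1 ≤ y → y < q → ∃ λ t → 2 ^ t % q ≡ y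
  powers-of-2-onto y 1≤y y<q = from-exponent (injective-in-interval⇒onto 1 exponent exponent-positive
                                 exponent<q exponent-injective y 1≤y y<q)
    where
    exponent<q : ∀ t → exponent t < q
    exponent<q t = subst (exponent t <_) order≡q (m%n<n (2 ^ toℕ t) order)
    from-exponent : (∃ λ t → exponent t ≡ y) → ∃ λ t → 2 ^ t % q ≡ y
    from-exponent (t , eₜ≡y) = toℕ t , trans (sym (%-modulus-≡ (2 ^ toℕ t) order≡q)) eₜ≡y

  -- a proper divisor c of q is ≡ 2 ^ t, so divides 2 ^ t, and is odd as it divides N
  q-prime : Prime q
  q-prime = prime λ { (composite c<q c∣q) → no-proper-divisor c<q c∣q }
    where
    no-proper-divisor : ∀ {c} .{{_ : NonTrivial c}} → c < q → c ∣ q → ⊥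
    no-proper-divisor {c} c<q c∣q = nonTrivial⇒≢1 (odd∣2^⇒≡1 c-odd t c∣2^t)
      where
      power : ∃ λ t → 2 ^ t % q ≡ c
      power = powers-of-2-onto c (<⇒≤ (nonTrivial⇒n>1 c)) c<q
      t : ℕ
      t = proj₁ power
      c∣2^t : c ∣ 2 ^ t
      c∣2^t = ∣n∣m%n⇒∣m c∣q (subst (c ∣_) (sym (proj₂ power)) ∣-refl)
      c-odd : ¬ 2 ∣ c
      c-odd 2∣c = N-odd (∣-trans 2∣c (∣-trans c∣q (subst (_∣ N) order≡q (order-∣ a^N≈1))))

  2-generates : IsGeneratorModUnits 2 q
  2-generates = coprime-sym (prime⇒coprime q-prime (s≤s (s≤s n>0))) , generates
    where
    generates : ∀ y → 1 ≤ y → y < q → Coprime y q → ∃ λ i → 2 ^ i ≡ₘ y [mod q ]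
    generates y 1≤y y<q _ = proj₁ power , trans (proj₂ power) (sym (m<n⇒m%n≡m y<q))
      where
      power : ∃ λ t → 2 ^ t % q ≡ y
      power = powers-of-2-onto y 1≤y y<q

-- Let p = 2q + 1 and q = n + 2 be primes with 2 a
-- generator modulo q.  By Fermat 4 ^ q = 2 ^ (p − 1) ≈ 1 modulo p, and 4 ≉ 1,
-- so 4 has order q modulo p; and 2 has order q − 1 modulo q.  Hence the
-- numbers 4 ^ (2 ^ t), t ≤ n, are pairwise incongruent modulo p, while
-- 4 ^ (2 ^ (n + 1)) ≈ 4 ^ (2 ^ (q − 1) mod q) = 4: a cycle of length q − 1.
module GeneratorCycle (p : ℕ) (p-prime : Prime p) (n : ℕ) (2q+1≡p : 2 * suc (suc n) + 1 ≡ p)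
                      (n>0 : 0 < n) (q-prime : Prime (suc (suc n))) (2-generates : IsGeneratorModUnits 2 (suc (suc n))) where
  open PrimeModulus p p-prime
  module ModQ = PrimeModulus (suc (suc n)) q-prime

  q : ℕ
  q = suc (suc n)

  7≤p : 7 ≤ p
  7≤p = subst (7 ≤_) 2q+1≡p (+-monoˡ-≤ 1 (*-monoʳ-≤ 2 (s≤s (s≤s n>0))))

  4<p : 4 < p
  4<p = ≤-trans (s≤s (s≤s (s≤s (s≤s (s≤s z≤n))))) 7≤p

  4^q≈1 : 4 ^ q ≈ 1
  4^q≈1 = Fermat.4^q≈1 p p-prime {q} 2q+1≡p (residue∤ z<s (<-trans (s≤s (s≤s (s≤s z≤n))) 4<p))

  module Four = UnitOrder (residue∤ z<s 4<p) (order-of 4 q z<s 4^q≈1)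

  -- the order of 4 divides the prime q and is not 1
  order-4≡q : Four.order ≡ q
  order-4≡q = fromInj₂ (λ order≡1 → ⊥-elim (4≉1 (subst (λ e → 4 ^ e ≈ 1) order≡1 Four.pow-order)))
                       (prime⇒irreducible q-prime (Four.order-∣ 4^q≈1))
    where
    4≉1 : ¬ 4 * 1 ≈ 1
    4≉1 4≈1 with () ← residue-≈⇒≡ 4<p 1<p 4≈1

  q∤2 : q ∤ 2
  q∤2 = >⇒∤ (s≤s (s≤s n>0))

  module Two = ModQ.UnitOrder q∤2 (ModQ.order-of 2 (q ∸ 1) z<s (Fermat.fermat-unit q q-prime q∤2))

  -- the discrete logarithms of 1, …, q − 1 are distinct modulo the order of 2
  q-1≤order-2 : suc n ≤ Two.order
  q-1≤order-2 = injective-in-interval⇒≤ 0 Two.order log (λ _ → z≤n) (λ i → m%n<n _ Two.order) log-injective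
    where
    discrete-log : ∀ (i : Fin (suc n)) → ∃ λ t → 2 ^ t ≡ₘ suc (toℕ i) [mod q ]
    discrete-log i = proj₂ 2-generates (suc (toℕ i)) (s≤s z≤n) (s≤s (toℕ<n i))
                       (coprime-sym (prime⇒coprime q-prime (s≤s (toℕ<n i))))
    log : Fin (suc n) → ℕ
    log i = proj₁ (discrete-log i) % Two.order
    log-injective : Injective _≡_ _≡_ log
    log-injective {i} {j} logᵢ≡logⱼ = toℕ-injective (suc-injective
      (ModQ.residue-≈⇒≡ (s≤s (toℕ<n i)) (s≤s (toℕ<n j)) (begin
        suc (toℕ i)                 ≈⟨ ModQ.≡ₘ⇒≈ (proj₂ (discrete-log i)) ⟨
        2 ^ proj₁ (discrete-log i)  ≈⟨ Two.pow-≈-order logᵢ≡logⱼ ⟩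
        2 ^ proj₁ (discrete-log j)  ≈⟨ ModQ.≡ₘ⇒≈ (proj₂ (discrete-log j)) ⟩
        suc (toℕ j)                 ∎)))
      where open ModQ.≈-Reasoning

  powers-distinct : ∀ {i j : Fin (suc n)} → 4 ^ (2 ^ toℕ i) ≈ 4 ^ (2 ^ toℕ j) → i ≡ j
  powers-distinct {i} {j} 4^2^i≈4^2^j = toℕ-injective (Two.pow-injective-below
    (≤-trans (toℕ<n i) q-1≤order-2) (≤-trans (toℕ<n j) q-1≤order-2)
    (ModQ.mod-eq (trans (sym (%-modulus-≡ (2 ^ toℕ i) order-4≡q))
                 (trans (Four.pow-injective 4^2^i≈4^2^j) (%-modulus-≡ (2 ^ toℕ j) order-4≡q)))))

  returns : 4 ^ (2 ^ suc n) ≈ 4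
  returns = begin
    4 ^ (2 ^ suc n)         ≈⟨ pow-≈-exponent-mod 4 q 4^q≈1 (2 ^ suc n) ⟩
    4 ^ (2 ^ suc n % q)     ≡⟨ cong (4 ^_) (ModQ.same-remainder (Fermat.fermat-unit q q-prime q∤2)) ⟩
    4 ^ (1 % q)             ≡⟨ cong (4 ^_) (m<n⇒m%n≡m {n = q} (s≤s (s≤s z≤n))) ⟩
    4 ^ 1                   ≡⟨ *-identityʳ 4 ⟩
    4                       ∎
    where open ≈-Reasoning

  maximal-cycle : MaxCycleLength p (suc n)
  maximal-cycle = (_ , squaring-cycle 4 n returns powers-distinct) , cycle-length≤ n 2q+1≡p

-- 2(l + 1) + 1 = 2l + 3: the two ways the statement relates p to l and to q.
2[l+1]+1≡2l+3 : ∀ l → 2 * suc l + 1 ≡ 2 * l + 3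
2[l+1]+1≡2l+3 = solve-∀

-- With q = l + 1, both sides say p = 2q + 1; the forward direction is
-- MaximalCycle and the backward one GeneratorCycle, for q ≥ 3.  The excluded
-- small case q = 2 is p = 5 = 2 ^ 2 ^ 1 + 1, where L(5) = 1 but 2 ≡ 0 (mod 2).
theorem1 : (p : ℕ) → Prime p → ¬ IsFermatNumber p →
    (∃ λ l → MaxCycleLength p l × 2 * l + 3 ≡ p)
      ⇔ (∃ λ q → 2 * q + 1 ≡ p × Prime q × IsGeneratorModUnits 2 q)
theorem1 p p-prime not-Fermat = mk⇔ forward backward
  where
  forward : (∃ λ l → MaxCycleLength p l × 2 * l + 3 ≡ p) →
            (∃ λ q → 2 * q + 1 ≡ p × Prime q × IsGeneratorModUnits 2 q)
  forward (zero , (() , _) , _)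
  forward (suc zero , _ , 5≡p) = ⊥-elim (not-Fermat (1 , sym 5≡p))
  forward (l@(suc (suc k)) , ((_ , c) , _) , 2l+3≡p) =
    suc l , 2q+1≡p , MaximalCycle.q-prime p p-prime (suc k) 2q+1≡p z<s c ,
                     MaximalCycle.2-generates p p-prime (suc k) 2q+1≡p z<s c
    where
    2q+1≡p : 2 * suc l + 1 ≡ p
    2q+1≡p = trans (2[l+1]+1≡2l+3 l) 2l+3≡p

  backward : (∃ λ q → 2 * q + 1 ≡ p × Prime q × IsGeneratorModUnits 2 q) →
             (∃ λ l → MaxCycleLength p l × 2 * l + 3 ≡ p)
  backward (zero , _ , q-prime , _)          = ⊥-elim (¬prime[0] q-prime)
  backward (suc zero , _ , q-prime , _)      = ⊥-elim (¬prime[1] q-prime)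
  backward (suc (suc zero) , 5≡p , _)        = ⊥-elim (not-Fermat (1 , sym 5≡p))
  backward (suc l@(suc (suc k)) , 2q+1≡p , q-prime , 2-generates) =
    l , GeneratorCycle.maximal-cycle p p-prime (suc k) 2q+1≡p z<s q-prime 2-generates ,
        trans (sym (2[l+1]+1≡2l+3 l)) 2q+1≡p
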